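{- Let $n \geq 1$ and let $\{b^x_k\}_{k=1}^{n}$, for $x \in \{0,1,\dots,n\}$, be $n+1$ orthonormal bases of $\mathbb{C}^n$ that are pairwise mutually unbiased, i.e. $|\langle b^x_k | b^y_l\rangle|^2 = 1/n$ for all $x \neq y$ and all $k,l$. For a function $f:\{0,\dots,n\}\to\{1,\dots,n\}$ define $$|\mu_f\rangle := \frac{1}{\sqrt{n}}\Big(\sum_{x=0}^{n} \overline{b^x_{f(x)}}\otimes b^x_{f(x)} \;-\; \sum_{k=1}^{n} e_k\otimes e_k\Big)\in \mathbb{C}^n\otimes\mathbb{C}^n,$$ where $(e_k)$ is the standard basis and $\overline{v}$ denotes entrywise complex conjugation in that basis. Then for any two functions $f,g:\{0,\dots,n\}\to\{1,\dots,n\}$, $$n\,\langle \mu_f|\mu_g\rangle + 1 = f\diamond g,$$ where $f \diamond g := |\{a : f(a)=g(a)\}|$ is the number of collisions of $f$ and $g$.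
   Context: $[n+1]$ denotes a set with $n+1$ elements, here $\{0,\dots,n\}$, and $[n]=\{1,\dots,n\}$. The vector $\mu_f$ is the "associated bipartite state" of the function $f$ with respect to the given family of bases: one sums, over all basis labels $x$, the product of the conjugate and the ordinary basis vector of basis $x$ with outcome $f(x)$, and subtracts the (unnormalized) maximally entangled vector. -}

module Defs where

open import Level using (Level; _⊔_; suc)
open import Data.Nat using (ℕ) renaming (suc to 1+)
open import Data.Fin using (Fin; _≟_)
open import Relation.Binary.PropositionalEquality using (_≢_)
import Algebra.Definitions.RawMonoid as RM
open import Relation.Nullary using (yes; no)
open import Data.List using (length; filter; allFin)
open import Algebra.Bundles using (CommutativeRing)
import Algebra.Properties.CommutativeMonoid.Sum as SumProps

-- A commutative ring with an involution ("*-ring").  The complex numbers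
-- with complex conjugation are the intended instance.
record StarCommRing (c ℓ : Level) : Set (suc (c ⊔ ℓ)) where
  field
    commRing : CommutativeRing c ℓ
  open CommutativeRing commRing public
  field
    conj        : Carrier → Carrier
    conj-cong   : ∀ {x y} → x ≈ y → conj x ≈ conj y
    conj-+      : ∀ x y → conj (x + y) ≈ conj x + conj y
    conj-*      : ∀ x y → conj (x * y) ≈ conj x * conj y
    conj-1      : conj 1# ≈ 1#
    conj-invol  : ∀ x → conj (conj x) ≈ x

module Hilbert {c ℓ : Level} (R : StarCommRing c ℓ) where
  open StarCommRing R public
  open SumProps +-commutativeMonoid public using (sum)
  open RM +-rawMonoid public using (_×_)

  Vec : ℕ → Set c
  Vec n = Fin n → Carrier

  -- vectors of K^n ⊗ K^n, as coordinate arrays  (e_i ⊗ e_j ↦ entry i j)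
  Vec² : ℕ → Set c
  Vec² n = Fin n → Fin n → Carrier

  ⟨_∣_⟩ : ∀ {n} → Vec n → Vec n → Carrier
  ⟨ u ∣ v ⟩ = sum (λ i → conj (u i) * v i)

  ⟨_∣_⟩² : ∀ {n} → Vec² n → Vec² n → Carrier
  ⟨ u ∣ v ⟩² = sum (λ i → sum (λ j → conj (u i j) * v i j))

  conjV : ∀ {n} → Vec n → Vec n
  conjV u i = conj (u i)

  _⊗_ : ∀ {n} → Vec n → Vec n → Vec² n
  (u ⊗ v) i j = u i * v j

  e : ∀ {n} → Fin n → Vec n
  e k i with k ≟ i
  ... | yes _ = 1#
  ... | no  _ = 0#

  δ : ∀ {n} → Fin n → Fin n → Carrier
  δ k l = e k l

  -- A family of n+1 orthonormal bases of K^n: b x k is the k-th vector of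
  -- basis x.  (n orthonormal vectors in K^n form an orthonormal basis.)
  Bases : ℕ → Set c
  Bases n = Fin (1+ n) → Fin n → Vec n

  Orthonormal : ∀ {n} → Bases n → Set ℓ
  Orthonormal {n} b = ∀ x k l → ⟨ b x k ∣ b x l ⟩ ≈ δ k l

  -- pairwise mutually unbiased: |⟨b^x_k|b^y_l⟩|² = 1/n, i.e. n·|⟨…⟩|² = 1
  MutuallyUnbiased : ∀ {n} → Bases n → Set ℓ
  MutuallyUnbiased {n} b = ∀ x y → x ≢ y → ∀ k l →
    n × (conj ⟨ b x k ∣ b y l ⟩ * ⟨ b x k ∣ b y l ⟩) ≈ 1#

  _·²_ : ∀ {n} → Carrier → Vec² n → Vec² n
  (s ·² w) i j = s * w i j

  -- |μ_f⟩ = s (Σ_x conj(b^x_{f x}) ⊗ b^x_{f x} − Σ_k e_k ⊗ e_k),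
  -- where s plays the role of 1/√n (real, and n·s² = 1).
  μ : ∀ {n} → Bases n → Carrier → (Fin (1+ n) → Fin n) → Vec² n
  μ b s f = s ·² (λ i j →
      sum (λ x → (conjV (b x (f x)) ⊗ b x (f x)) i j)
    - sum (λ k → (e k ⊗ e k) i j))

  _⋄_ : ∀ {n m} → (Fin n → Fin m) → (Fin n → Fin m) → ℕ
  _⋄_ {n} f g = length (filter (λ a → f a ≟ g a) (allFin n))

-- For a family of vectors u write Σconj⊗ u := Σₓ conj(uₓ) ⊗ uₓ. The inner product of two
-- such tensors is a Gram-type sum: ⟨Σconj⊗ u ∣ Σconj⊗ v⟩ = Σₓ Σᵧ |⟨uₓ ∣ vᵧ⟩|². As
-- Σₖ eₖ ⊗ eₖ = Σconj⊗ e, expanding ⟨μ_f ∣ μ_g⟩ bilinearly leaves four such sums. Parseval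
-- against the standard basis evaluates the three involving e to n+1, n+1 and n, while in
-- the fourth the off-diagonal terms x ≠ y each contribute 1/n by unbiasedness and the
-- diagonal ones contribute δ(f x, g x) by orthonormality, giving (n+1) + f ⋄ g.
module Submission where

open import Defs
open import Level using (Level)
open import Data.Nat using (ℕ; _≥_) renaming (suc to 1+)
open import Data.Fin using (Fin; zero; suc; _≟_; punchIn)
open import Data.Fin.Properties using (suc-injective; punchInᵢ≢i)
open import Data.List using (length; filter; tabulate)
open import Data.Empty using (⊥-elim)
open import Relation.Nullary using (Dec; yes; no)
open import Relation.Binary.PropositionalEquality as ≡ using (_≡_; _≢_)
import Algebra.Properties.Ring as RingProperties
import Algebra.Properties.Group as GroupProperties
import Algebra.Properties.Semiring.Sum as SumProperties
import Algebra.Properties.Semiring.Mult as MultProperties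
import Algebra.Properties.CommutativeSemigroup as CommutativeSemigroupProperties
import Relation.Binary.Reasoning.Setoid as SetoidReasoning

module Development {c ℓ : Level} (R : StarCommRing c ℓ) where
  open Hilbert R hiding (zero)
  open RingProperties ring using (-1*x≈-x; x[y-z]≈xy-xz; [y-z]x≈yx-zx; x+x≈x⇒x≈0)
  open GroupProperties +-group using (inverseʳ-unique)
  open SumProperties semiring using (sum-cong-≋; sum-replicate; sum-remove; ∑-distrib-+; ∑-comm;
                                     *-distribˡ-sum; *-distribʳ-sum)
  open MultProperties semiring using (×-assoc-*; ×-comm-*; ×-congʳ)
  open CommutativeSemigroupProperties *-commutativeSemigroup using (interchange)
  open SetoidReasoning setoid

  abs² : Carrier → Carrier
  abs² z = conj z * z

  abs²-cong : ∀ {z w} → z ≈ w → abs² z ≈ abs² w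
  abs²-cong z≈w = *-cong (conj-cong z≈w) z≈w

  ×-inverse-unique : ∀ n {a z} → n × a ≈ 1# → n × z ≈ 1# → z ≈ a
  ×-inverse-unique n {a} {z} na≈1 nz≈1 = begin
    z             ≈⟨ *-identityʳ z ⟨
    z * 1#        ≈⟨ *-congˡ na≈1 ⟨
    z * (n × a)   ≈⟨ ×-comm-* n z a ⟩
    n × (z * a)   ≈⟨ ×-assoc-* n z a ⟨
    (n × z) * a   ≈⟨ *-congʳ nz≈1 ⟩
    1# * a        ≈⟨ *-identityˡ a ⟩
    a             ∎

  ∑-distrib-‿ : ∀ {m} (u v : Fin m → Carrier) → sum (λ i → u i - v i) ≈ sum u - sum v
  ∑-distrib-‿ u v = begin
    sum (λ i → u i - v i)           ≈⟨ ∑-distrib-+ u (λ i → - v i) ⟩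
    sum u + sum (λ i → - v i)       ≈⟨ +-congˡ (sum-cong-≋ (λ i → -1*x≈-x (v i))) ⟨
    sum u + sum (λ i → - 1# * v i)  ≈⟨ +-congˡ (*-distribˡ-sum (- 1#) v) ⟨
    sum u + - 1# * sum v            ≈⟨ +-congˡ (-1*x≈-x (sum v)) ⟩
    sum u - sum v                   ∎

  sum-*-sum : ∀ {m k} (u : Fin m → Carrier) (v : Fin k → Carrier) →
              sum u * sum v ≈ sum (λ x → sum (λ y → u x * v y))
  sum-*-sum u v = trans (*-distribʳ-sum (sum v) u) (sum-cong-≋ (λ x → *-distribˡ-sum (u x) v))

  ∑²-comm : ∀ {m₁ m₂ k₁ k₂} (F : Fin m₁ → Fin m₂ → Fin k₁ → Fin k₂ → Carrier) →
            sum (λ i → sum (λ j → sum (λ x → sum (λ y → F i j x y)))) ≈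
            sum (λ x → sum (λ y → sum (λ i → sum (λ j → F i j x y))))
  ∑²-comm F = begin
    sum (λ i → sum (λ j → sum (λ x → sum (λ y → F i j x y))))
      ≈⟨ sum-cong-≋ (λ i → ∑-comm (λ j x → sum (F i j x))) ⟩
    sum (λ i → sum (λ x → sum (λ j → sum (λ y → F i j x y))))
      ≈⟨ ∑-comm (λ i x → sum (λ j → sum (F i j x))) ⟩
    sum (λ x → sum (λ i → sum (λ j → sum (λ y → F i j x y))))
      ≈⟨ sum-cong-≋ (λ x → sum-cong-≋ (λ i → ∑-comm (λ j y → F i j x y))) ⟩
    sum (λ x → sum (λ i → sum (λ y → sum (λ j → F i j x y))))
      ≈⟨ sum-cong-≋ (λ x → ∑-comm (λ i y → sum (λ j → F i j x y))) ⟩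
    sum (λ x → sum (λ y → sum (λ i → sum (λ j → F i j x y)))) ∎

  conj-0# : conj 0# ≈ 0#
  conj-0# = x+x≈x⇒x≈0 _ (trans (sym (conj-+ 0# 0#)) (conj-cong (+-identityˡ 0#)))

  conj-‿ : ∀ z → conj (- z) ≈ - conj z
  conj-‿ z = inverseʳ-unique (conj z) (conj (- z))
    (trans (sym (conj-+ z (- z))) (trans (conj-cong (-‿inverseʳ z)) conj-0#))

  conj-sum : ∀ {m} (u : Fin m → Carrier) → conj (sum u) ≈ sum (λ i → conj (u i))
  conj-sum {0}    u = conj-0#
  conj-sum {1+ m} u = trans (conj-+ _ _) (+-congˡ (conj-sum (λ i → u (suc i))))

  conj-conj-* : ∀ z w → conj (conj z * w) ≈ z * conj w
  conj-conj-* z w = trans (conj-* (conj z) w) (*-congʳ (conj-invol z))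

  e-≡ : ∀ {n} {k i : Fin n} → k ≡ i → e k i ≈ 1#
  e-≡ {k = k} {i} k≡i with k ≟ i
  ... | yes _   = refl
  ... | no k≢i = ⊥-elim (k≢i k≡i)

  e-≢ : ∀ {n} {k i : Fin n} → k ≢ i → e k i ≈ 0#
  e-≢ {k = k} {i} k≢i with k ≟ i
  ... | yes k≡i = ⊥-elim (k≢i k≡i)
  ... | no _    = refl

  e-suc : ∀ {n} (k i : Fin n) → e (suc k) (suc i) ≈ e k i
  e-suc k i = by-cases (k ≟ i)
    where
    by-cases : Dec (k ≡ i) → e (suc k) (suc i) ≈ e k i
    by-cases (yes k≡i) = trans (e-≡ (≡.cong suc k≡i)) (sym (e-≡ k≡i))
    by-cases (no k≢i)  = trans (e-≢ (λ sk≡si → k≢i (suc-injective sk≡si))) (sym (e-≢ k≢i))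

  conj-e : ∀ {n} (k i : Fin n) → conj (e k i) ≈ e k i
  conj-e k i with k ≟ i
  ... | yes _ = conj-1
  ... | no _  = conj-0#

  abs²-e : ∀ {n} (k i : Fin n) → abs² (e k i) ≈ e k i
  abs²-e k i with k ≟ i
  ... | yes _ = trans (*-congʳ conj-1) (*-identityˡ 1#)
  ... | no _  = trans (*-congʳ conj-0#) (zeroˡ 0#)

  ∑-e-select : ∀ {n} (k : Fin n) (v : Vec n) → sum (λ i → e k i * v i) ≈ v k
  ∑-e-select {1+ n} zero v = begin
    1# * v zero + sum (λ i → 0# * v (suc i))
      ≈⟨ +-cong (*-identityˡ (v zero)) (sym (*-distribˡ-sum 0# (λ i → v (suc i)))) ⟩
    v zero + 0# * sum (λ i → v (suc i))
      ≈⟨ +-congˡ (zeroˡ _) ⟩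
    v zero + 0#
      ≈⟨ +-identityʳ (v zero) ⟩
    v zero ∎
  ∑-e-select {1+ n} (suc k) v = begin
    0# * v zero + sum (λ i → e (suc k) (suc i) * v (suc i))
      ≈⟨ +-congˡ (sum-cong-≋ (λ i → *-congʳ (e-suc k i))) ⟩
    0# * v zero + sum (λ i → e k i * v (suc i))
      ≈⟨ +-cong (zeroˡ (v zero)) (∑-e-select k (λ i → v (suc i))) ⟩
    0# + v (suc k)
      ≈⟨ +-identityˡ (v (suc k)) ⟩
    v (suc k) ∎

  ⟨e∣_⟩ : ∀ {n} (k : Fin n) (v : Vec n) → ⟨ e k ∣ v ⟩ ≈ v k
  ⟨e∣_⟩ k v = trans (sum-cong-≋ (λ i → *-congʳ (conj-e k i))) (∑-e-select k v)

  ⟨_∣e⟩ : ∀ {n} (u : Vec n) (k : Fin n) → ⟨ u ∣ e k ⟩ ≈ conj (u k)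
  ⟨_∣e⟩ u k = trans (sum-cong-≋ (λ i → *-comm (conj (u i)) (e k i))) (∑-e-select k (conjV u))

  ⟨e∣e⟩ : ∀ {n} (k : Fin n) → ⟨ e k ∣ e k ⟩ ≈ 1#
  ⟨e∣e⟩ k = trans (⟨e∣_⟩ k (e k)) (e-≡ {k = k} ≡.refl)

  parsevalʳ : ∀ {n} (u : Vec n) → sum (λ k → abs² ⟨ u ∣ e k ⟩) ≈ ⟨ u ∣ u ⟩
  parsevalʳ u = sum-cong-≋ (λ k → begin
    abs² ⟨ u ∣ e k ⟩                ≈⟨ abs²-cong (⟨_∣e⟩ u k) ⟩
    conj (conj (u k)) * conj (u k)  ≈⟨ *-congʳ (conj-invol (u k)) ⟩
    u k * conj (u k)                ≈⟨ *-comm (u k) (conj (u k)) ⟩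
    conj (u k) * u k                ∎)

  parsevalˡ : ∀ {n} (v : Vec n) → sum (λ k → abs² ⟨ e k ∣ v ⟩) ≈ ⟨ v ∣ v ⟩
  parsevalˡ v = sum-cong-≋ (λ k → abs²-cong (⟨e∣_⟩ k v))

  Σconj⊗ : ∀ {m n} → (Fin m → Vec n) → Vec² n
  Σconj⊗ u i j = sum (λ x → (conjV (u x) ⊗ u x) i j)

  ∑e⊗e≈Σconj⊗e : ∀ {n} (i j : Fin n) → sum (λ k → (e k ⊗ e k) i j) ≈ Σconj⊗ e i j
  ∑e⊗e≈Σconj⊗e i j = sum-cong-≋ (λ k → *-congʳ (sym (conj-e k i)))

  abs²-⟨∣⟩-expansion : ∀ {n} (a b : Vec n) →
    sum (λ i → sum (λ j → (a i * conj (a j)) * (conj (b i) * b j))) ≈ abs² ⟨ a ∣ b ⟩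
  abs²-⟨∣⟩-expansion a b = sym (begin
    conj ⟨ a ∣ b ⟩ * ⟨ a ∣ b ⟩
      ≈⟨ *-congʳ (trans (conj-sum (λ i → conj (a i) * b i)) (sum-cong-≋ (λ i → conj-conj-* (a i) (b i)))) ⟩
    sum (λ i → a i * conj (b i)) * ⟨ a ∣ b ⟩
      ≈⟨ sum-*-sum (λ i → a i * conj (b i)) (λ j → conj (a j) * b j) ⟩
    sum (λ i → sum (λ j → (a i * conj (b i)) * (conj (a j) * b j)))
      ≈⟨ sum-cong-≋ (λ i → sum-cong-≋ (λ j → interchange (a i) (conj (b i)) (conj (a j)) (b j))) ⟩
    sum (λ i → sum (λ j → (a i * conj (a j)) * (conj (b i) * b j))) ∎)

  Σconj⊗-inner : ∀ {m m′ n} (u : Fin m → Vec n) (v : Fin m′ → Vec n) →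
    ⟨ Σconj⊗ u ∣ Σconj⊗ v ⟩² ≈ sum (λ x → sum (λ y → abs² ⟨ u x ∣ v y ⟩))
  Σconj⊗-inner u v = begin
    sum (λ i → sum (λ j → conj (Σconj⊗ u i j) * Σconj⊗ v i j))
      ≈⟨ sum-cong-≋ (λ i → sum-cong-≋ (λ j → entry i j)) ⟩
    sum (λ i → sum (λ j → sum (λ x → sum (λ y → F i j x y))))
      ≈⟨ ∑²-comm F ⟩
    sum (λ x → sum (λ y → sum (λ i → sum (λ j → F i j x y))))
      ≈⟨ sum-cong-≋ (λ x → sum-cong-≋ (λ y → abs²-⟨∣⟩-expansion (u x) (v y))) ⟩
    sum (λ x → sum (λ y → abs² ⟨ u x ∣ v y ⟩)) ∎
    where
    F : _ → _ → _ → _ → Carrier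
    F i j x y = (u x i * conj (u x j)) * (conj (v y i) * v y j)

    entry : ∀ i j → conj (Σconj⊗ u i j) * Σconj⊗ v i j ≈ sum (λ x → sum (λ y → F i j x y))
    entry i j = trans
      (*-congʳ (trans (conj-sum (λ x → conj (u x i) * u x j)) (sum-cong-≋ (λ x → conj-conj-* (u x i) (u x j)))))
      (sum-*-sum (λ x → u x i * conj (u x j)) (λ y → conj (v y i) * v y j))

  Σconj⊗-inner-eʳ : ∀ {m n} (u : Fin m → Vec n) → (∀ x → ⟨ u x ∣ u x ⟩ ≈ 1#) →
                    ⟨ Σconj⊗ u ∣ Σconj⊗ e ⟩² ≈ m × 1#
  Σconj⊗-inner-eʳ {m} u unit = begin
    ⟨ Σconj⊗ u ∣ Σconj⊗ e ⟩²                       ≈⟨ Σconj⊗-inner u e ⟩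
    sum (λ x → sum (λ k → abs² ⟨ u x ∣ e k ⟩))    ≈⟨ sum-cong-≋ (λ x → trans (parsevalʳ (u x)) (unit x)) ⟩
    sum {m} (λ _ → 1#)                            ≈⟨ sum-replicate m ⟩
    m × 1#                                        ∎

  Σconj⊗-inner-eˡ : ∀ {m n} (v : Fin m → Vec n) → (∀ y → ⟨ v y ∣ v y ⟩ ≈ 1#) →
                    ⟨ Σconj⊗ e ∣ Σconj⊗ v ⟩² ≈ m × 1#
  Σconj⊗-inner-eˡ {m} v unit = begin
    ⟨ Σconj⊗ e ∣ Σconj⊗ v ⟩²                       ≈⟨ Σconj⊗-inner e v ⟩
    sum (λ k → sum (λ y → abs² ⟨ e k ∣ v y ⟩))    ≈⟨ ∑-comm (λ k y → abs² ⟨ e k ∣ v y ⟩) ⟩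
    sum (λ y → sum (λ k → abs² ⟨ e k ∣ v y ⟩))    ≈⟨ sum-cong-≋ (λ y → trans (parsevalˡ (v y)) (unit y)) ⟩
    sum {m} (λ _ → 1#)                            ≈⟨ sum-replicate m ⟩
    m × 1#                                        ∎

  _-²_ : ∀ {n} → Vec² n → Vec² n → Vec² n
  (M -² N) i j = M i j - N i j

  ⟨⟩²-cong : ∀ {n} {M M′ N N′ : Vec² n} → (∀ i j → M i j ≈ M′ i j) → (∀ i j → N i j ≈ N′ i j) →
             ⟨ M ∣ N ⟩² ≈ ⟨ M′ ∣ N′ ⟩²
  ⟨⟩²-cong M≈M′ N≈N′ = sum-cong-≋ (λ i → sum-cong-≋ (λ j → *-cong (conj-cong (M≈M′ i j)) (N≈N′ i j)))

  ⟨·²∣·²⟩² : ∀ {n} s t (M N : Vec² n) → ⟨ s ·² M ∣ t ·² N ⟩² ≈ (conj s * t) * ⟨ M ∣ N ⟩²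
  ⟨·²∣·²⟩² s t M N = begin
    sum (λ i → sum (λ j → conj (s * M i j) * (t * N i j)))
      ≈⟨ sum-cong-≋ (λ i → sum-cong-≋ (λ j → entry (M i j) (N i j))) ⟩
    sum (λ i → sum (λ j → (conj s * t) * (conj (M i j) * N i j)))
      ≈⟨ sum-cong-≋ (λ i → *-distribˡ-sum (conj s * t) (λ j → conj (M i j) * N i j)) ⟨
    sum (λ i → (conj s * t) * sum (λ j → conj (M i j) * N i j))
      ≈⟨ *-distribˡ-sum (conj s * t) (λ i → ⟨ M i ∣ N i ⟩) ⟨
    (conj s * t) * ⟨ M ∣ N ⟩² ∎
    where
    entry : ∀ z w → conj (s * z) * (t * w) ≈ (conj s * t) * (conj z * w)
    entry z w = trans (*-congʳ (conj-* s z)) (interchange (conj s) (conj z) t w)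

  ×⟨s·²∣s·²⟩² : ∀ {n} m {s} (M N : Vec² n) → conj s ≈ s → m × (s * s) ≈ 1# →
                 m × ⟨ s ·² M ∣ s ·² N ⟩² ≈ ⟨ M ∣ N ⟩²
  ×⟨s·²∣s·²⟩² m {s} M N s-real m·s²≈1 = begin
    m × ⟨ s ·² M ∣ s ·² N ⟩²        ≈⟨ ×-congʳ m (⟨·²∣·²⟩² s s M N) ⟩
    m × ((conj s * s) * ⟨ M ∣ N ⟩²)  ≈⟨ ×-congʳ m (*-congʳ (*-congʳ s-real)) ⟩
    m × ((s * s) * ⟨ M ∣ N ⟩²)       ≈⟨ ×-assoc-* m (s * s) _ ⟨
    (m × (s * s)) * ⟨ M ∣ N ⟩²       ≈⟨ *-congʳ m·s²≈1 ⟩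
    1# * ⟨ M ∣ N ⟩²                  ≈⟨ *-identityˡ _ ⟩
    ⟨ M ∣ N ⟩²                       ∎

  ⟨-²∣-²⟩² : ∀ {n} (M M′ N N′ : Vec² n) →
    ⟨ M -² M′ ∣ N -² N′ ⟩² ≈ (⟨ M ∣ N ⟩² - ⟨ M ∣ N′ ⟩²) - (⟨ M′ ∣ N ⟩² - ⟨ M′ ∣ N′ ⟩²)
  ⟨-²∣-²⟩² M M′ N N′ = begin
    ⟨ M -² M′ ∣ N -² N′ ⟩²
      ≈⟨ sum-cong-≋ (λ i → sum-cong-≋ (λ j → entry (M i j) (M′ i j) (N i j) (N′ i j))) ⟩
    sum (λ i → sum (λ j → (P i j - P′ i j) - (Q i j - Q′ i j)))
      ≈⟨ ∑²-distrib-‿ (λ i j → P i j - P′ i j) (λ i j → Q i j - Q′ i j) ⟩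
    sum (λ i → sum (λ j → P i j - P′ i j)) - sum (λ i → sum (λ j → Q i j - Q′ i j))
      ≈⟨ +-cong (∑²-distrib-‿ P P′) (-‿cong (∑²-distrib-‿ Q Q′)) ⟩
    (⟨ M ∣ N ⟩² - ⟨ M ∣ N′ ⟩²) - (⟨ M′ ∣ N ⟩² - ⟨ M′ ∣ N′ ⟩²) ∎
    where
    P P′ Q Q′ : Vec² _
    P  i j = conj (M i j) * N i j
    P′ i j = conj (M i j) * N′ i j
    Q  i j = conj (M′ i j) * N i j
    Q′ i j = conj (M′ i j) * N′ i j

    ∑²-distrib-‿ : (U V : Vec² _) → sum (λ i → sum (λ j → U i j - V i j)) ≈
                   sum (λ i → sum (λ j → U i j)) - sum (λ i → sum (λ j → V i j))
    ∑²-distrib-‿ U V = trans (sum-cong-≋ (λ i → ∑-distrib-‿ (U i) (V i)))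
                              (∑-distrib-‿ (λ i → sum (U i)) (λ i → sum (V i)))

    entry : ∀ z z′ w w′ → conj (z - z′) * (w - w′) ≈
                          (conj z * w - conj z * w′) - (conj z′ * w - conj z′ * w′)
    entry z z′ w w′ = begin
      conj (z - z′) * (w - w′)
        ≈⟨ *-congʳ (trans (conj-+ z (- z′)) (+-congˡ (conj-‿ z′))) ⟩
      (conj z - conj z′) * (w - w′)
        ≈⟨ [y-z]x≈yx-zx (w - w′) (conj z) (conj z′) ⟩
      conj z * (w - w′) - conj z′ * (w - w′)
        ≈⟨ +-cong (x[y-z]≈xy-xz (conj z) w w′) (-‿cong (x[y-z]≈xy-xz (conj z′) w w′)) ⟩
      (conj z * w - conj z * w′) - (conj z′ * w - conj z′ * w′) ∎

  μ≈·²-² : ∀ {n} (b : Bases n) s f i j → μ b s f i j ≈ (s ·² (Σconj⊗ (λ x → b x (f x)) -² Σconj⊗ e)) i j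
  μ≈·²-² b s f i j = *-congˡ (+-congˡ (-‿cong (∑e⊗e≈Σconj⊗e i j)))

  ∑-δ-tabulate : ∀ {A : Set} {m k} (p q : A → Fin k) (t : Fin m → A) →
    sum (λ x → δ (p (t x)) (q (t x))) ≈ length (filter (λ a → p a ≟ q a) (tabulate t)) × 1#
  ∑-δ-tabulate {m = 0}    p q t = refl
  ∑-δ-tabulate {m = 1+ m} p q t with p (t zero) ≟ q (t zero)
  ... | yes _ = +-congˡ (∑-δ-tabulate p q (λ x → t (suc x)))
  ... | no _  = trans (+-identityˡ _) (∑-δ-tabulate p q (λ x → t (suc x)))

  ∑-δ≈collisions : ∀ {m k} (f g : Fin m → Fin k) → sum (λ x → δ (f x) (g x)) ≈ (f ⋄ g) × 1#
  ∑-δ≈collisions f g = ∑-δ-tabulate f g (λ x → x)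

  module Unbiased {n} (b : Bases n) (orthonormal : Orthonormal b) (unbiased : MutuallyUnbiased b)
                  (s : Carrier) (n·s²≈1 : n × (s * s) ≈ 1#) where

    unit : ∀ x k → ⟨ b x k ∣ b x k ⟩ ≈ 1#
    unit x k = trans (orthonormal x k k) (e-≡ {k = k} ≡.refl)

    abs²-orthonormal : ∀ x k l → abs² ⟨ b x k ∣ b x l ⟩ ≈ δ k l
    abs²-orthonormal x k l = trans (abs²-cong (orthonormal x k l)) (abs²-e k l)

    abs²-unbiased : ∀ {x y} → x ≢ y → ∀ k l → abs² ⟨ b x k ∣ b y l ⟩ ≈ s * s
    abs²-unbiased x≢y k l = ×-inverse-unique n n·s²≈1 (unbiased _ _ x≢y k l)

    ∑-abs²-across-bases : ∀ x k (g : Fin (1+ n) → Fin n) →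
      sum (λ y → abs² ⟨ b x k ∣ b y (g y) ⟩) ≈ δ k (g x) + 1#
    ∑-abs²-across-bases x k g = begin
      sum t                                    ≈⟨ sum-remove t ⟩
      t x + sum (λ j → t (punchIn x j))        ≈⟨ +-cong (abs²-orthonormal x k (g x)) (sum-cong-≋ off-diagonal) ⟩
      δ k (g x) + sum {n} (λ _ → s * s)        ≈⟨ +-congˡ (trans (sum-replicate n) n·s²≈1) ⟩
      δ k (g x) + 1#                           ∎
      where
      t : Fin (1+ n) → Carrier
      t y = abs² ⟨ b x k ∣ b y (g y) ⟩

      off-diagonal : ∀ j → t (punchIn x j) ≈ s * s
      off-diagonal j = abs²-unbiased (λ x≡x′ → punchInᵢ≢i x j (≡.sym x≡x′)) k (g (punchIn x j))

    Σconj⊗-inner-bases : ∀ (f g : Fin (1+ n) → Fin n) →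
      ⟨ Σconj⊗ (λ x → b x (f x)) ∣ Σconj⊗ (λ y → b y (g y)) ⟩² ≈
      sum (λ x → δ (f x) (g x)) + (1+ n) × 1#
    Σconj⊗-inner-bases f g = begin
      ⟨ Σconj⊗ (λ x → b x (f x)) ∣ Σconj⊗ (λ y → b y (g y)) ⟩²
        ≈⟨ Σconj⊗-inner (λ x → b x (f x)) (λ y → b y (g y)) ⟩
      sum (λ x → sum (λ y → abs² ⟨ b x (f x) ∣ b y (g y) ⟩))
        ≈⟨ sum-cong-≋ (λ x → ∑-abs²-across-bases x (f x) g) ⟩
      sum (λ x → δ (f x) (g x) + 1#)
        ≈⟨ ∑-distrib-+ (λ x → δ (f x) (g x)) (λ _ → 1#) ⟩
      sum (λ x → δ (f x) (g x)) + sum {1+ n} (λ _ → 1#)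
        ≈⟨ +-congˡ (sum-replicate (1+ n)) ⟩
      sum (λ x → δ (f x) (g x)) + (1+ n) × 1# ∎

lemma33 : ∀ {c ℓ : Level} (R : StarCommRing c ℓ) → let open Hilbert R in
    (n : ℕ) → n ≥ 1 →
    (b : Bases n) → Orthonormal b → MutuallyUnbiased b →
    (s : Carrier) → conj s ≈ s → n × (s * s) ≈ 1# →
    (f g : Fin (1+ n) → Fin n) →
    n × ⟨ μ b s f ∣ μ b s g ⟩² + 1# ≈ (f ⋄ g) × 1#
lemma33 R n _ b orthonormal unbiased s s-real n·s²≈1 f g = begin
  n × ⟨ μ b s f ∣ μ b s g ⟩² + 1#
    ≈⟨ +-congʳ (×-congʳ n (⟨⟩²-cong (μ≈·²-² b s f) (μ≈·²-² b s g))) ⟩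
  n × ⟨ s ·² (Φf -² Φe) ∣ s ·² (Φg -² Φe) ⟩² + 1#
    ≈⟨ +-congʳ (×⟨s·²∣s·²⟩² n (Φf -² Φe) (Φg -² Φe) s-real n·s²≈1) ⟩
  ⟨ Φf -² Φe ∣ Φg -² Φe ⟩² + 1#
    ≈⟨ +-congʳ (⟨-²∣-²⟩² Φf Φe Φg Φe) ⟩
  ((⟨ Φf ∣ Φg ⟩² - ⟨ Φf ∣ Φe ⟩²) - (⟨ Φe ∣ Φg ⟩² - ⟨ Φe ∣ Φe ⟩²)) + 1#
    ≈⟨ +-congʳ (+-cong (+-cong (Σconj⊗-inner-bases f g) (-‿cong (Σconj⊗-inner-eʳ bf (λ x → unit x (f x)))))
                       (-‿cong (+-cong (Σconj⊗-inner-eˡ bg (λ y → unit y (g y)))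
                                       (-‿cong (Σconj⊗-inner-eʳ {n} e ⟨e∣e⟩))))) ⟩
  ((D + N) - N) - ((1# + n × 1#) - n × 1#) + 1#
    ≈⟨ +-congʳ (+-cong (//-rightDividesʳ N D) (-‿cong (//-rightDividesʳ (n × 1#) 1#))) ⟩
  (D - 1#) + 1#
    ≈⟨ //-rightDividesˡ 1# D ⟩
  D
    ≈⟨ ∑-δ≈collisions f g ⟩
  (f ⋄ g) × 1# ∎
  where
  open Hilbert R
  open Development R
  open Unbiased b orthonormal unbiased s n·s²≈1
  open GroupProperties +-group using (//-rightDividesˡ; //-rightDividesʳ)
  open MultProperties semiring using (×-congʳ)
  open SetoidReasoning setoid

  bf bg : Fin (1+ n) → Vec n
  bf x = b x (f x)
  bg y = b y (g y)

  Φf Φg Φe : Vec² n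
  Φf = Σconj⊗ bf
  Φg = Σconj⊗ bg
  Φe = Σconj⊗ {n} e

  D N : Carrier
  D = sum (λ x → δ (f x) (g x))
  N = (1+ n) × 1#
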